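{- Let $H=(V,E)$ be a linear $k$-uniform hypergraph ($k\ge 2$) and let $\ell$ be an integer with $0\leq\ell\leq\max\{k,d_H\}$. If $W=(w_1,\dots,w_\ell)$ is a sequence of $\ell$ distinct vertices of $V$, then there exists a $D_H$-degenerate ordering $u_1,\ldots,u_{|V|}$ of $V$ such that $u_i=w_i$ for $1\le i\le\ell$.
   Context: A $k$-uniform hypergraph is linear if any two distinct edges share at most one vertex. $d_H=\max\{\delta(J):J\subseteq H\}$ (maximum over subhypergraphs $J$ of the minimum degree of $J$), $D_H=\min\{k d_H,\Delta(H)\}$ with $\Delta(H)$ the maximum degree. An ordering $v_1,\dots,v_m$ of $V(H)$ is $d$-degenerate if $d_{H_i}(v_i)\le d$ for all $1\le i\le m$, where $H_i=H[\{v_1,\dots,v_i\}]$ is the induced subhypergraph and $d_{H_i}(v_i)$ is the degree of $v_i$ in $H_i$. -}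

module Defs where

open import Data.Nat using (ℕ; zero; suc; _≤_; _≤ᵇ_; _*_; _⊓_; _⊔_)
open import Data.Bool using (Bool; true; false; _∧_; _∨_; not)
open import Data.Fin using (Fin; toℕ)
open import Data.Fin.Subset using (Subset; _∈_; _∩_; ∣_∣; Nonempty; Empty; _⊆_)
open import Data.Fin.Subset.Properties using (_∈?_)
open import Data.Fin.Permutation using (Permutation′; _⟨$⟩ʳ_; _⟨$⟩ˡ_)
open import Data.Vec using (Vec; []; _∷_; lookup; tabulate)
open import Data.Product using (Σ; ∃; _×_; _,_)
open import Relation.Nullary using (does; ¬_)
open import Relation.Binary.PropositionalEquality using (_≡_; _≢_)

record Hypergraph (n m : ℕ) : Set where
  constructor hypergraph
  field
    edge : Fin m → Subset n
open Hypergraph public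

_⊆ᵇ_ : ∀ {n} → Subset n → Subset n → Bool
[]      ⊆ᵇ []      = true
(a ∷ p) ⊆ᵇ (b ∷ q) = (not a ∨ b) ∧ (p ⊆ᵇ q)

module _ {n m : ℕ} (H : Hypergraph n m) where

  Uniform : ℕ → Set
  Uniform k = ∀ (e : Fin m) → ∣ edge H e ∣ ≡ k

  Linear : Set
  Linear = ∀ (e f : Fin m) → e ≢ f → ∣ edge H e ∩ edge H f ∣ ≤ 1

  edgesAt : Fin n → Subset m
  edgesAt v = tabulate (λ e → does (v ∈? edge H e))

  record Sub : Set where
    constructor sub
    field
      verts : Subset n
      edges : Subset m
      closed : ∀ (e : Fin m) → e ∈ edges → edge H e ⊆ verts
  open Sub public

  degIn : Subset m → Fin n → ℕ
  degIn T v = ∣ T ∩ edgesAt v ∣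

  deg : Fin n → ℕ
  deg v = degIn (tabulate (λ _ → true)) v

  IsMinDegree : Sub → ℕ → Set
  IsMinDegree J d =
    (Empty (verts J) → d ≡ 0) ×
    (Nonempty (verts J) →
       (∃ λ v → v ∈ verts J × degIn (edges J) v ≡ d) ×
       (∀ v → v ∈ verts J → d ≤ degIn (edges J) v))

  -- d_H = max { δ(J) : J ⊆ H }
  IsDegeneracy : ℕ → Set
  IsDegeneracy d =
    (∃ λ (J : Sub) → IsMinDegree J d) ×
    (∀ (J : Sub) (d′ : ℕ) → IsMinDegree J d′ → d′ ≤ d)

  IsMaxDegree : ℕ → Set
  IsMaxDegree Δ =
    (n ≡ 0 → Δ ≡ 0) ×
    (∀ v → deg v ≤ Δ) ×
    (Fin n → ∃ λ v → deg v ≡ Δ)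

  -- the first i+1 vertices of the ordering π (i.e. {π 0, …, π i})
  prefix : Permutation′ n → Fin n → Subset n
  prefix π i = tabulate (λ v → toℕ (π ⟨$⟩ˡ v) ≤ᵇ toℕ i)

  inducedEdges : Subset n → Subset m
  inducedEdges P = tabulate (λ e → edge H e ⊆ᵇ P)

  Degenerate : ℕ → Permutation′ n → Set
  Degenerate D π = ∀ (i : Fin n) → degIn (inducedEdges (prefix π i)) (π ⟨$⟩ʳ i) ≤ D

-- Build the ordering from the back. While the current vertex set S contains vertices outside W,
-- choose one, v, of degree at most kd in H[S], put it last and delete it; when only W is left,
-- list it in its given order. In a linear hypergraph two vertices share at most one edge, so a
-- vertex of a set P ⊆ W has degree at most |W| ≤ max(k, d) ≤ kd in H[P] (d ≥ 1 unless H has no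
-- edges at all).
-- For v take a vertex of degree at most d in H[S ∖ W]: every other edge of H[S] at v contains a
-- vertex of W, distinct such edges contain distinct ones, so v has degree at most d + |W| in H[S],
-- which is at most kd unless d = 1 and |W| = k. In that case first delete, one at a time, vertices
-- of W of degree at most 1 in what is left, losing at most one edge each. Once none remains, a
-- vertex v of degree at most 1 lies outside W and meets at most one lost edge per deleted vertex.
-- This bounds its degree in H[S] by k, except when all of W was deleted and every lost edge
-- contains v; then a vertex of degree at most 1 in the remaining set minus v meets at most one
-- lost edge, namely one through v.
-- The bound Δ holds for every ordering.

module Submission where

open import Defs
open import Data.Bool using (true; T)
open import Data.Bool.Properties using (T-≡)
open import Data.Empty using (⊥-elim)
open import Data.Fin using (Fin; zero; suc; toℕ; _↑ˡ_; _↑ʳ_; splitAt)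
open import Data.Fin.Properties
  using (_≟_; any?; suc-injective; toℕ-injective; toℕ-↑ˡ; toℕ-↑ʳ; toℕ<n; splitAt⁻¹-↑ˡ; splitAt⁻¹-↑ʳ;
         injective⇒≤)
open import Data.Fin.Permutation using (Permutation′; permutation; _⟨$⟩ʳ_; _⟨$⟩ˡ_; inverseˡ; inverseʳ)
open import Data.Fin.Subset
open import Data.Fin.Subset.Induction using (Acc; acc; ⊂-wellFounded)
open import Data.Fin.Subset.Properties
open import Data.Nat using (ℕ; zero; suc; _+_; _*_; _⊓_; _⊔_; _≤_; _<_; _≤?_; _<?_; _≤ᵇ_; z≤n; s≤s)
open import Data.Nat.Properties
  using (≤-refl; ≤-trans; ≤-reflexive; ≤-antisym; ≤-pred; <-≤-trans; <⇒≱; ≮⇒≥; ≰⇒>;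
         +-suc; +-comm; +-identityʳ; +-mono-≤; +-monoʳ-≤; m≤m+n; m≤m*n; m≤n*m;
         *-monoʳ-≤; *-monoˡ-≤; *-identityʳ; *-identityˡ; ⊔-identityʳ; ⊔-lub; ⊓-glb; ≤ᵇ⇒≤; ≤⇒≤ᵇ;
         module ≤-Reasoning)
open import Data.Product using (∃; _×_; _,_; proj₁; proj₂)
open import Data.Sum using (inj₁; inj₂)
open import Data.Vec using (_∷_; []; tabulate; here; there)
open import Data.Vec.Properties using (lookup∘tabulate; lookup⇒[]=; []=⇒lookup)
import Data.Vec.Functional as Vector
open import Data.Vec.Functional.Properties using (lookup-++ˡ; lookup-++ʳ)
open import Function using (_∘_; case_of_; Equivalence)
open import Function.Definitions using (Injective)
open import Relation.Nullary using (¬_; yes; no; does; contradiction; _×-dec_; ¬?)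
open import Relation.Nullary.Decidable using (dec-true; decidable-stable)
open import Relation.Binary.PropositionalEquality using (_≡_; _≢_; refl; sym; trans; cong; subst; subst₂)

private variable
  a b n : ℕ
  p q r : Subset n
  x y : Fin n

-- Finite subsets

x∈p─q⇒x∉q : x ∈ p ─ q → x ∉ q
x∈p─q⇒x∉q {p = inside ∷ p} {q = outside ∷ q} here ()
x∈p─q⇒x∉q {p = _ ∷ p} {q = outside ∷ q} (there x∈) (there x∈q) = x∈p─q⇒x∉q x∈ x∈q
x∈p─q⇒x∉q {p = _ ∷ p} {q = inside ∷ q} (there x∈) (there x∈q) = x∈p─q⇒x∉q x∈ x∈q

∣p∣≡∣p─q∣+∣p∩q∣ : ∀ (p q : Subset n) → ∣ p ∣ ≡ ∣ p ─ q ∣ + ∣ p ∩ q ∣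
∣p∣≡∣p─q∣+∣p∩q∣ []            []            = refl
∣p∣≡∣p─q∣+∣p∩q∣ (outside ∷ p) (outside ∷ q) = ∣p∣≡∣p─q∣+∣p∩q∣ p q
∣p∣≡∣p─q∣+∣p∩q∣ (outside ∷ p) (inside  ∷ q) = ∣p∣≡∣p─q∣+∣p∩q∣ p q
∣p∣≡∣p─q∣+∣p∩q∣ (inside  ∷ p) (outside ∷ q) = cong suc (∣p∣≡∣p─q∣+∣p∩q∣ p q)
∣p∣≡∣p─q∣+∣p∩q∣ (inside  ∷ p) (inside  ∷ q) =
  trans (cong suc (∣p∣≡∣p─q∣+∣p∩q∣ p q)) (sym (+-suc ∣ p ─ q ∣ ∣ p ∩ q ∣))

∣p∪q∣≤∣p∣+∣q∣ : ∀ (p q : Subset n) → ∣ p ∪ q ∣ ≤ ∣ p ∣ + ∣ q ∣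
∣p∪q∣≤∣p∣+∣q∣ []            []            = z≤n
∣p∪q∣≤∣p∣+∣q∣ (outside ∷ p) (outside ∷ q) = ∣p∪q∣≤∣p∣+∣q∣ p q
∣p∪q∣≤∣p∣+∣q∣ (outside ∷ p) (inside  ∷ q) =
  ≤-trans (s≤s (∣p∪q∣≤∣p∣+∣q∣ p q)) (≤-reflexive (sym (+-suc ∣ p ∣ ∣ q ∣)))
∣p∪q∣≤∣p∣+∣q∣ (inside  ∷ p) (s       ∷ q) =
  s≤s (≤-trans (∣p∪q∣≤∣p∣+∣q∣ p q) (+-monoʳ-≤ ∣ p ∣ (∣p∣≤∣x∷p∣ s q)))

Empty⇒∣p∣≡0 : Empty p → ∣ p ∣ ≡ 0
Empty⇒∣p∣≡0 {n} p-empty = trans (cong ∣_∣ (Empty-unique p-empty)) (∣⊥∣≡0 n)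

x∈p⇒1≤∣p∣ : x ∈ p → 1 ≤ ∣ p ∣
x∈p⇒1≤∣p∣ {x = x} x∈p =
  ≤-trans (≤-reflexive (sym (∣⁅x⁆∣≡1 x))) (p⊆q⇒∣p∣≤∣q∣ (λ y∈ → subst (_∈ _) (sym (x∈⁅y⁆⇒x≡y x y∈)) x∈p))

1≤∣p∣⇒Nonempty : 1 ≤ ∣ p ∣ → Nonempty p
1≤∣p∣⇒Nonempty {p = p} 1≤∣p∣ with nonempty? p
... | yes p≠∅ = p≠∅
... | no  p=∅ = contradiction (Empty⇒∣p∣≡0 p=∅) λ ∣p∣≡0 → <⇒≱ 1≤∣p∣ (≤-reflexive ∣p∣≡0)

distinct⇒2≤∣p∣ : x ∈ p → y ∈ p → x ≢ y → 2 ≤ ∣ p ∣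
distinct⇒2≤∣p∣ x∈p y∈p x≢y =
  <-≤-trans (s≤s (x∈p⇒1≤∣p∣ (x∈p∧x≢y⇒x∈p-y y∈p (x≢y ∘ sym)))) (x∈p⇒∣p-x∣<∣p∣ x∈p)

unique⇒∣p∣≤1 : (∀ {x y} → x ∈ p → y ∈ p → x ≡ y) → ∣ p ∣ ≤ 1
unique⇒∣p∣≤1 {p = []}          _      = z≤n
unique⇒∣p∣≤1 {p = outside ∷ p} unique = unique⇒∣p∣≤1 λ x∈ y∈ → suc-injective (unique (there x∈) (there y∈))
unique⇒∣p∣≤1 {p = inside  ∷ p} unique =
  s≤s (≤-reflexive (Empty⇒∣p∣≡0 λ { (x , x∈p) → case unique (there x∈p) here of λ () }))

p⊆q∧∣q∣≤∣p∣⇒q⊆p : p ⊆ q → ∣ q ∣ ≤ ∣ p ∣ → q ⊆ p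
p⊆q∧∣q∣≤∣p∣⇒q⊆p {p = p} p⊆q ∣q∣≤∣p∣ {x} x∈q with x ∈? p
... | yes x∈p = x∈p
... | no  x∉p = contradiction ∣q∣≤∣p∣ (<⇒≱ (p⊂q⇒∣p∣<∣q∣ (p⊆q , x , x∈q , x∉p)))

⊈⇒∃∉ : ¬ p ⊆ q → ∃ λ x → x ∈ p × x ∉ q
⊈⇒∃∉ {p = p} {q} p⊈q with any? (λ x → x ∈? p ×-dec ¬? (x ∈? q))
... | yes witness = witness
... | no  none    = contradiction (λ {x} x∈p → decidable-stable (x ∈? q) λ x∉q → none (x , x∈p , x∉q)) p⊈q

p─q⊆p─r : r ⊆ q → p ─ q ⊆ p ─ r
p─q⊆p─r {r = r} {q = q} {p = p} r⊆q x∈p─q =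
  x∈p∧x∉q⇒x∈p─q (p─q⊆p p q x∈p─q) (λ x∈r → x∈p─q⇒x∉q x∈p─q (r⊆q x∈r))

∈-tabulate⁺ : ∀ {f : Fin n → _} → f x ≡ true → x ∈ tabulate f
∈-tabulate⁺ {x = x} {f} fx = lookup⇒[]= x (tabulate f) (trans (lookup∘tabulate f x) fx)

∈-tabulate⁻ : ∀ {f : Fin n → _} → x ∈ tabulate f → f x ≡ true
∈-tabulate⁻ {x = x} {f} x∈ = trans (sym (lookup∘tabulate f x)) ([]=⇒lookup x∈)

covered⇒∣p∣≤∣q∣ : ∀ {p : Subset a} (q : Subset b) (N : Fin b → Subset a) →
  (∀ {x} → x ∈ p → ∃ λ y → y ∈ q × x ∈ N y) →
  (∀ {y} → y ∈ q → ∣ p ∩ N y ∣ ≤ 1) →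
  ∣ p ∣ ≤ ∣ q ∣
covered⇒∣p∣≤∣q∣ [] N cover _ = ≤-reflexive (Empty⇒∣p∣≡0 λ { (x , x∈p) → case cover x∈p of λ { (() , _) } })
covered⇒∣p∣≤∣q∣ (outside ∷ q) N cover atMostOne =
  covered⇒∣p∣≤∣q∣ q (N ∘ suc) cover′ (atMostOne ∘ there)
  where
  cover′ : ∀ {x} → x ∈ _ → ∃ λ y → y ∈ q × x ∈ N (suc y)
  cover′ x∈p with cover x∈p
  ... | suc y , there y∈q , x∈N = y , y∈q , x∈N
covered⇒∣p∣≤∣q∣ {p = p} (inside ∷ q) N cover atMostOne = begin
    ∣ p ∣                          ≡⟨ ∣p∣≡∣p─q∣+∣p∩q∣ p (N zero) ⟩
    ∣ p ─ N zero ∣ + ∣ p ∩ N zero ∣ ≤⟨ +-mono-≤ rest (atMostOne here) ⟩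
    ∣ q ∣ + 1                      ≡⟨ +-comm ∣ q ∣ 1 ⟩
    suc ∣ q ∣                      ∎
  where
  open ≤-Reasoning
  cover′ : ∀ {x} → x ∈ p ─ N zero → ∃ λ y → y ∈ q × x ∈ N (suc y)
  cover′ x∈p─N with cover (p─q⊆p p (N zero) x∈p─N)
  ... | zero  , _          , x∈N = contradiction x∈N (x∈p─q⇒x∉q x∈p─N)
  ... | suc y , there y∈q , x∈N = y , y∈q , x∈N
  shrink : ∀ r → (p ─ N zero) ∩ r ⊆ p ∩ r
  shrink r x∈ = let (x∈p─N , x∈r) = x∈p∩q⁻ _ r x∈ in x∈p∩q⁺ (p─q⊆p p (N zero) x∈p─N , x∈r)
  rest : ∣ p ─ N zero ∣ ≤ ∣ q ∣
  rest = covered⇒∣p∣≤∣q∣ q (N ∘ suc) cover′ λ y∈q →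
    ≤-trans (p⊆q⇒∣p∣≤∣q∣ (shrink _)) (atMostOne (there y∈q))

∃-minimiser : (f : Fin n → ℕ) → Nonempty p → ∃ λ v → v ∈ p × ∀ {u} → u ∈ p → f v ≤ f u
∃-minimiser {p = p} f (u , u∈p) = descend (f u) u u∈p ≤-refl
  where
  descend : ∀ c u → u ∈ p → f u ≤ c → ∃ λ v → v ∈ p × ∀ {w} → w ∈ p → f v ≤ f w
  descend c u u∈p fu≤c with any? (λ w → w ∈? p ×-dec f w <? f u)
  ... | no  none = u , u∈p , λ {w} w∈p → ≮⇒≥ λ fw<fu → none (w , w∈p , fw<fu)
  descend zero    u u∈p fu≤0   | yes (w , _ , fw<fu) = contradiction (≤-trans fw<fu fu≤0) λ ()
  descend (suc c) u u∈p fu≤1+c | yes (w , w∈p , fw<fu) = descend c w w∈p (≤-pred (≤-trans fw<fu fu≤1+c))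

image : (Fin a → Fin n) → Subset n
image f = tabulate λ u → does (any? λ i → f i ≟ u)

∈-image⁺ : ∀ (f : Fin a → Fin n) i → f i ∈ image f
∈-image⁺ f i = ∈-tabulate⁺ (dec-true (any? λ j → f j ≟ f i) (i , refl))

∈-image⁻ : ∀ (f : Fin a → Fin n) → x ∈ image f → ∃ λ i → f i ≡ x
∈-image⁻ {x = x} f x∈ with any? (λ i → f i ≟ x) | ∈-tabulate⁻ {f = λ u → does (any? λ i → f i ≟ u)} x∈
... | yes witness | _ = witness

∣image∣≤ : ∀ (f : Fin a → Fin n) → ∣ image f ∣ ≤ a
∣image∣≤ {a} f = ≤-trans (covered⇒∣p∣≤∣q∣ ⊤ (λ i → ⁅ f i ⁆) cover atMostOne) (≤-reflexive (∣⊤∣≡n a))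
  where
  cover : ∀ {x} → x ∈ image f → ∃ λ i → i ∈ ⊤ × x ∈ ⁅ f i ⁆
  cover x∈ with ∈-image⁻ f x∈
  ... | i , refl = i , ∈⊤ , x∈⁅x⁆ (f i)
  atMostOne : ∀ {i} → i ∈ ⊤ → ∣ image f ∩ ⁅ f i ⁆ ∣ ≤ 1
  atMostOne {i} _ = ≤-trans (∣p∩q∣≤∣q∣ (image f) ⁅ f i ⁆) (≤-reflexive (∣⁅x⁆∣≡1 (f i)))

-- Induced subhypergraphs

⊆ᵇ⇒⊆ : (p ⊆ᵇ q) ≡ true → p ⊆ q
⊆ᵇ⇒⊆ {p = outside ∷ p} {q = _       ∷ q} p⊆ᵇq (there x∈p) = there (⊆ᵇ⇒⊆ p⊆ᵇq x∈p)
⊆ᵇ⇒⊆ {p = inside  ∷ p} {q = inside  ∷ q} p⊆ᵇq here        = here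
⊆ᵇ⇒⊆ {p = inside  ∷ p} {q = inside  ∷ q} p⊆ᵇq (there x∈p) = there (⊆ᵇ⇒⊆ p⊆ᵇq x∈p)
⊆ᵇ⇒⊆ {p = inside  ∷ p} {q = outside ∷ q} ()

⊆⇒⊆ᵇ : p ⊆ q → (p ⊆ᵇ q) ≡ true
⊆⇒⊆ᵇ {p = []}          {q = []}          _   = refl
⊆⇒⊆ᵇ {p = outside ∷ p} {q = _       ∷ q} p⊆q = ⊆⇒⊆ᵇ (drop-∷-⊆ p⊆q)
⊆⇒⊆ᵇ {p = inside  ∷ p} {q = inside  ∷ q} p⊆q = ⊆⇒⊆ᵇ (drop-∷-⊆ p⊆q)
⊆⇒⊆ᵇ {p = inside  ∷ p} {q = outside ∷ q} p⊆q = contradiction (p⊆q here) λ ()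

module _ {n m : ℕ} (H : Hypergraph n m) where

  inducedDeg : Subset n → Fin n → ℕ
  inducedDeg P v = degIn H (inducedEdges H P) v

  star : Subset n → Fin n → Subset m
  star P v = inducedEdges H P ∩ edgesAt H v

  lost : Subset n → Subset n → Subset m
  lost S S′ = inducedEdges H S ─ inducedEdges H S′

  InducedMinDegree≤ : ℕ → Set
  InducedMinDegree≤ c = ∀ {P} → Nonempty P → ∃ λ v → v ∈ P × inducedDeg P v ≤ c

  private variable
    P S S′ S″ : Subset n
    u v w : Fin n
    e : Fin m

  ∈-edgesAt⁺ : v ∈ edge H e → e ∈ edgesAt H v
  ∈-edgesAt⁺ {v = v} {e = e} v∈e = ∈-tabulate⁺ (dec-true (v ∈? edge H e) v∈e)

  ∈-edgesAt⁻ : ∀ v → e ∈ edgesAt H v → v ∈ edge H e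
  ∈-edgesAt⁻ {e = e} v e∈ with v ∈? edge H e | ∈-tabulate⁻ {f = λ e → does (v ∈? edge H e)} e∈
  ... | yes v∈e | _ = v∈e

  ∈-inducedEdges⁺ : edge H e ⊆ P → e ∈ inducedEdges H P
  ∈-inducedEdges⁺ e⊆P = ∈-tabulate⁺ (⊆⇒⊆ᵇ e⊆P)

  ∈-inducedEdges⁻ : e ∈ inducedEdges H P → edge H e ⊆ P
  ∈-inducedEdges⁻ e∈ = ⊆ᵇ⇒⊆ (∈-tabulate⁻ e∈)

  ∈-star⁺ : edge H e ⊆ P → v ∈ edge H e → e ∈ star P v
  ∈-star⁺ e⊆P v∈e = x∈p∩q⁺ (∈-inducedEdges⁺ e⊆P , ∈-edgesAt⁺ v∈e)

  ∈-star⁻ : ∀ v → e ∈ star P v → edge H e ⊆ P × v ∈ edge H e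
  ∈-star⁻ v e∈ with x∈p∩q⁻ _ _ e∈
  ... | e∈H[P] , e∈v = ∈-inducedEdges⁻ e∈H[P] , ∈-edgesAt⁻ v e∈v

  inducedDeg≤deg : inducedDeg P v ≤ deg H v
  inducedDeg≤deg {P} {v} = p⊆q⇒∣p∣≤∣q∣ {p = star P v} λ e∈ → x∈p∩q⁺ (∈-tabulate⁺ refl , proj₂ (x∈p∩q⁻ _ _ e∈))

  Degenerate-⊓ : ∀ {D D′ π} → Degenerate H D π → Degenerate H D′ π → Degenerate H (D ⊓ D′) π
  Degenerate-⊓ D-degenerate D′-degenerate i = ⊓-glb (D-degenerate i) (D′-degenerate i)

  maxDegree⇒Degenerate : ∀ {Δ} → IsMaxDegree H Δ → ∀ π → Degenerate H Δ π
  maxDegree⇒Degenerate (_ , deg≤Δ , _) π i =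
    ≤-trans (inducedDeg≤deg {P = prefix H π i} {v = π ⟨$⟩ʳ i}) (deg≤Δ (π ⟨$⟩ʳ i))

  inducedDeg≤+lost : inducedDeg S v ≤ inducedDeg S′ v + ∣ lost S S′ ∩ edgesAt H v ∣
  inducedDeg≤+lost {S} {v} {S′} =
    ≤-trans (p⊆q⇒∣p∣≤∣q∣ split) (∣p∪q∣≤∣p∣+∣q∣ (star S′ v) (lost S S′ ∩ edgesAt H v))
    where
    split : star S v ⊆ star S′ v ∪ (lost S S′ ∩ edgesAt H v)
    split {e} e∈ with x∈p∩q⁻ _ _ e∈ | e ∈? inducedEdges H S′
    ... | _      , e∈v | yes e∈H[S′] = x∈p∪q⁺ (inj₁ (x∈p∩q⁺ (e∈H[S′] , e∈v)))
    ... | e∈H[S] , e∈v | no  e∉H[S′] = x∈p∪q⁺ (inj₂ (x∈p∩q⁺ (x∈p∧x∉q⇒x∈p─q e∈H[S] e∉H[S′] , e∈v)))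

  lost-trans : lost S S″ ⊆ lost S S′ ∪ lost S′ S″
  lost-trans {S} {S″} {S′} {e} e∈ with e ∈? inducedEdges H S′
  ... | yes e∈H[S′] = x∈p∪q⁺ (inj₂ (x∈p∧x∉q⇒x∈p─q e∈H[S′] (x∈p─q⇒x∉q e∈)))
  ... | no  e∉H[S′] = x∈p∪q⁺ (inj₁ (x∈p∧x∉q⇒x∈p─q (p─q⊆p _ _ e∈) e∉H[S′]))

  lost-remove : lost P (P - w) ⊆ star P w
  lost-remove {P} {w} {e} e∈ with ⊈⇒∃∉ (λ e⊆P-w → x∈p─q⇒x∉q e∈ (∈-inducedEdges⁺ e⊆P-w))
  ... | x , x∈e , x∉P-w with x ≟ w
  ...   | yes refl = ∈-star⁺ (∈-inducedEdges⁻ (p─q⊆p _ _ e∈)) x∈e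
  ...   | no  x≢w  = contradiction (x∈p∧x≢y⇒x∈p-y (∈-inducedEdges⁻ (p─q⊆p _ _ e∈) x∈e) x≢w) x∉P-w

  degeneracy⇒InducedMinDegree≤ : ∀ {d} → IsDegeneracy H d → InducedMinDegree≤ d
  degeneracy⇒InducedMinDegree≤ (_ , maximal) {P} P≠∅ with ∃-minimiser (inducedDeg P) P≠∅
  ... | v , v∈P , minimal = v , v∈P , maximal H[P] (inducedDeg P v) isMinDegree
    where
    H[P] : Sub H
    H[P] = sub P (inducedEdges H P) (λ _ → ∈-inducedEdges⁻)
    isMinDegree : IsMinDegree H H[P] (inducedDeg P v)
    isMinDegree = (λ P=∅ → ⊥-elim (P=∅ P≠∅)) , λ _ → (v , v∈P , refl) , λ _ → minimal

  module _ {k : ℕ} (uniform : Uniform H k) where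

    ∣P∣<k⇒inducedDeg≡0 : ∣ P ∣ < k → inducedDeg P v ≡ 0
    ∣P∣<k⇒inducedDeg≡0 {P} {v} ∣P∣<k = Empty⇒∣p∣≡0 {p = star P v} λ { (e , e∈) →
      <⇒≱ ∣P∣<k (subst (_≤ ∣ P ∣) (uniform e) (p⊆q⇒∣p∣≤∣q∣ (proj₁ (∈-star⁻ v e∈)))) }

    edge⇒1≤degeneracy : 1 ≤ k → ∀ {d} → IsDegeneracy H d → Fin m → 1 ≤ d
    edge⇒1≤degeneracy 1≤k isDeg e
      with degeneracy⇒InducedMinDegree≤ isDeg (1≤∣p∣⇒Nonempty (subst (1 ≤_) (sym (uniform e)) 1≤k))
    ... | v , v∈e , deg≤d = ≤-trans (x∈p⇒1≤∣p∣ (∈-star⁺ ⊆-refl v∈e)) deg≤d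

  module _ (linear : Linear H) where

    ∣commonEdges∣≤1 : ∀ {T : Subset m} → u ≢ v →
      (∀ {e} → e ∈ T → u ∈ edge H e × v ∈ edge H e) → ∣ T ∣ ≤ 1
    ∣commonEdges∣≤1 u≢v through = unique⇒∣p∣≤1 λ {e} {f} e∈ f∈ → unique e f (through e∈) (through f∈)
      where
      unique : ∀ e f → _ → _ → e ≡ f
      unique e f (u∈e , v∈e) (u∈f , v∈f) with e ≟ f
      ... | yes e≡f = e≡f
      ... | no  e≢f = contradiction (linear e f e≢f)
                        (<⇒≱ (distinct⇒2≤∣p∣ (x∈p∩q⁺ (u∈e , u∈f)) (x∈p∩q⁺ (v∈e , v∈f)) u≢v))

    ∣lost∩edgesAt∣≤∣S─S′∣ : v ∈ S′ → ∣ lost S S′ ∩ edgesAt H v ∣ ≤ ∣ S ─ S′ ∣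
    ∣lost∩edgesAt∣≤∣S─S′∣ {v} {S′} {S} v∈S′ = covered⇒∣p∣≤∣q∣ (S ─ S′) (edgesAt H) cover atMostOne
      where
      cover : ∀ {e} → e ∈ lost S S′ ∩ edgesAt H v → ∃ λ x → x ∈ S ─ S′ × e ∈ edgesAt H x
      cover e∈ with x∈p∩q⁻ _ _ e∈
      ... | e∈lost , _ with ⊈⇒∃∉ (λ e⊆S′ → x∈p─q⇒x∉q e∈lost (∈-inducedEdges⁺ e⊆S′))
      ... | x , x∈e , x∉S′ =
        x , x∈p∧x∉q⇒x∈p─q (∈-inducedEdges⁻ (p─q⊆p _ _ e∈lost) x∈e) x∉S′ , ∈-edgesAt⁺ x∈e
      atMostOne : ∀ {x} → x ∈ S ─ S′ → ∣ (lost S S′ ∩ edgesAt H v) ∩ edgesAt H x ∣ ≤ 1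
      atMostOne {x} x∈S─S′ = ∣commonEdges∣≤1 {T = (lost S S′ ∩ edgesAt H v) ∩ edgesAt H x}
        (λ { refl → x∈p─q⇒x∉q x∈S─S′ v∈S′ }) λ e∈ →
        let (e∈lost∩v , e∈x) = x∈p∩q⁻ _ _ e∈ in ∈-edgesAt⁻ x e∈x , ∈-edgesAt⁻ v (proj₂ (x∈p∩q⁻ _ _ e∈lost∩v))

    inducedDeg≤+removed : v ∈ S′ → inducedDeg S v ≤ inducedDeg S′ v + ∣ S ─ S′ ∣
    inducedDeg≤+removed {v} {S′} {S} v∈S′ =
      ≤-trans (inducedDeg≤+lost {S} {v} {S′}) (+-monoʳ-≤ (inducedDeg S′ v) (∣lost∩edgesAt∣≤∣S─S′∣ v∈S′))

-- Vertices of low degree outside a prescribed set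

∃-outside-inducedDeg≤c+∣A∣ : ∀ {n m} {H : Hypergraph n m} → Linear H → ∀ {c} → InducedMinDegree≤ H c →
  ∀ {S A} → Nonempty (S ─ A) → ∃ λ v → v ∈ S ─ A × inducedDeg H S v ≤ c + ∣ A ∣
∃-outside-inducedDeg≤c+∣A∣ {H = H} linear low {S} {A} S─A≠∅ with low S─A≠∅
... | v , v∈S─A , deg≤c = v , v∈S─A ,
  ≤-trans (inducedDeg≤+removed H linear {S = S} v∈S─A) (+-mono-≤ deg≤c (p⊆q⇒∣p∣≤∣q∣ removed⊆A))
  where
  removed⊆A : S ─ (S ─ A) ⊆ A
  removed⊆A {x} x∈ with x ∈? A
  ... | yes x∈A = x∈A
  ... | no  x∉A = contradiction (x∈p∧x∉q⇒x∈p─q (p─q⊆p _ _ x∈) x∉A) (x∈p─q⇒x∉q x∈)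

module Peeling {n m} {H : Hypergraph n m} {k} (2≤k : 2 ≤ k) (uniform : Uniform H k) (linear : Linear H)
  (low : InducedMinDegree≤ H 1) {S A : Subset n} (∣A∣≤k : ∣ A ∣ ≤ k) where

  record Peeled (S′ : Subset n) : Set where
    field
      S′⊆S : S′ ⊆ S
      removed⊆A : S ─ S′ ⊆ A
      ∣lost∣≤∣removed∣ : ∣ lost H S S′ ∣ ≤ ∣ S ─ S′ ∣

  LowOutsideVertex : Set
  LowOutsideVertex = ∃ λ v → v ∈ S ─ A × inducedDeg H S v ≤ k

  nothingPeeled : Peeled S
  nothingPeeled = record
    { S′⊆S = ⊆-refl
    ; removed⊆A = λ x∈S─S → contradiction (p─q⊆p _ _ x∈S─S) (x∈p─q⇒x∉q x∈S─S)
    ; ∣lost∣≤∣removed∣ = ≤-trans (≤-reflexive (Empty⇒∣p∣≡0 {p = lost H S S} λ { (e , e∈) →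
        x∈p─q⇒x∉q e∈ (p─q⊆p _ _ e∈) })) z≤n
    }

  module _ {S′} (peeled : Peeled S′) where
    open Peeled peeled

    S─A⊆S′ : S ─ A ⊆ S′
    S─A⊆S′ {x} x∈S─A with x ∈? S′
    ... | yes x∈S′ = x∈S′
    ... | no  x∉S′ = contradiction (removed⊆A (x∈p∧x∉q⇒x∈p─q (p─q⊆p _ _ x∈S─A) x∉S′)) (x∈p─q⇒x∉q x∈S─A)

    peel-step : ∀ {w} → w ∈ S′ → w ∈ A → inducedDeg H S′ w ≤ 1 → Peeled (S′ - w)
    peel-step {w} w∈S′ w∈A deg≤1 = record
      { S′⊆S = ⊆-trans (p─q⊆p S′ ⁅ w ⁆) S′⊆S
      ; removed⊆A = removed′⊆A
      ; ∣lost∣≤∣removed∣ = begin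
          ∣ lost H S (S′ - w) ∣               ≤⟨ p⊆q⇒∣p∣≤∣q∣ lost′⊆ ⟩
          ∣ lost H S S′ ∪ star H S′ w ∣        ≤⟨ ∣p∪q∣≤∣p∣+∣q∣ (lost H S S′) (star H S′ w) ⟩
          ∣ lost H S S′ ∣ + inducedDeg H S′ w ≤⟨ +-mono-≤ ∣lost∣≤∣removed∣ deg≤1 ⟩
          ∣ S ─ S′ ∣ + 1                       ≡⟨ +-comm ∣ S ─ S′ ∣ 1 ⟩
          suc ∣ S ─ S′ ∣                       ≤⟨ p⊂q⇒∣p∣<∣q∣ removed⊂removed′ ⟩
          ∣ S ─ (S′ - w) ∣                     ∎
      }
      where
      open ≤-Reasoning
      w∉S′-w : w ∉ S′ - w
      w∉S′-w w∈S′-w = x∈p─q⇒x∉q w∈S′-w (x∈⁅x⁆ w)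
      removed′⊆A : S ─ (S′ - w) ⊆ A
      removed′⊆A {x} x∈ with x ≟ w
      ... | yes refl = w∈A
      ... | no  x≢w  = removed⊆A (x∈p∧x∉q⇒x∈p─q (p─q⊆p _ _ x∈)
                         λ x∈S′ → x∈p─q⇒x∉q x∈ (x∈p∧x≢y⇒x∈p-y x∈S′ x≢w))
      removed⊂removed′ : S ─ S′ ⊂ S ─ (S′ - w)
      removed⊂removed′ = p─q⊆p─r (p─q⊆p S′ ⁅ w ⁆) , w ,
        x∈p∧x∉q⇒x∈p─q (S′⊆S w∈S′) w∉S′-w , λ w∈S─S′ → x∈p─q⇒x∉q w∈S─S′ w∈S′
      lost′⊆ : lost H S (S′ - w) ⊆ lost H S S′ ∪ star H S′ w
      lost′⊆ e∈ with x∈p∪q⁻ _ _ (lost-trans H {S′ = S′} e∈)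
      ... | inj₁ e∈lost = x∈p∪q⁺ (inj₁ e∈lost)
      ... | inj₂ e∈lost′ = x∈p∪q⁺ (inj₂ (lost-remove H e∈lost′))

    allPeeled⇒LowOutsideVertex : ∀ {v} → v ∈ S′ → v ∈ S ─ A → A ⊆ S ─ S′ → lost H S S′ ⊆ edgesAt H v →
      ∣ lost H S S′ ∩ edgesAt H v ∣ ≤ k → LowOutsideVertex
    allPeeled⇒LowOutsideVertex {v} v∈S′ v∈S─A A⊆removed lost⊆v lv≤k with nonempty? (S′ - v)
    ... | no S′-v=∅ = v , v∈S─A , ≤-trans (inducedDeg≤+lost H {S = S} {v = v} {S′ = S′})
          (+-mono-≤ (≤-reflexive (∣P∣<k⇒inducedDeg≡0 H uniform {v = v} ∣S′∣<k)) lv≤k)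
      where
      S′⊆⁅v⁆ : S′ ⊆ ⁅ v ⁆
      S′⊆⁅v⁆ {x} x∈S′ with x ≟ v
      ... | yes refl = x∈⁅x⁆ x
      ... | no  x≢v  = contradiction (x , x∈p∧x≢y⇒x∈p-y x∈S′ x≢v) S′-v=∅
      ∣S′∣<k : ∣ S′ ∣ < k
      ∣S′∣<k = ≤-trans (s≤s (≤-trans (p⊆q⇒∣p∣≤∣q∣ S′⊆⁅v⁆) (≤-reflexive (∣⁅x⁆∣≡1 v)))) 2≤k
    ... | yes S′-v≠∅ with low S′-v≠∅
    ...   | u , u∈S′-v , deg″≤1 = u , u∈S─A ,
            ≤-trans (inducedDeg≤+lost H {S = S} {v = u} {S′ = S′ - v}) (≤-trans (+-mono-≤ deg″≤1 lost″≤1) 2≤k)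
      where
      u∈S′ : u ∈ S′
      u∈S′ = p─q⊆p _ _ u∈S′-v
      u∈S─A : u ∈ S ─ A
      u∈S─A = x∈p∧x∉q⇒x∈p─q (S′⊆S u∈S′) λ u∈A → x∈p─q⇒x∉q (A⊆removed u∈A) u∈S′
      through-v : lost H S (S′ - v) ⊆ edgesAt H v
      through-v e∈ with x∈p∪q⁻ _ _ (lost-trans H {S′ = S′} e∈)
      ... | inj₁ e∈lost = lost⊆v e∈lost
      ... | inj₂ e∈lost′ = proj₂ (x∈p∩q⁻ _ _ (lost-remove H e∈lost′))
      lost″≤1 : ∣ lost H S (S′ - v) ∩ edgesAt H u ∣ ≤ 1
      lost″≤1 = ∣commonEdges∣≤1 H linear (x∉⁅y⁆⇒x≢y (x∈p─q⇒x∉q u∈S′-v)) λ e∈ →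
        let (e∈lost , e∈u) = x∈p∩q⁻ _ _ e∈ in ∈-edgesAt⁻ H u e∈u , ∈-edgesAt⁻ H v (through-v e∈lost)

    lowVertex⇒LowOutsideVertex : ∀ {v} → v ∈ S′ → v ∈ S ─ A → inducedDeg H S′ v ≤ 1 → LowOutsideVertex
    lowVertex⇒LowOutsideVertex {v} v∈S′ v∈S─A deg′≤1 with k ≤? ∣ lost H S S′ ∩ edgesAt H v ∣
    ... | no  lv≱k = v , v∈S─A , ≤-trans (inducedDeg≤+lost H {S = S} {v = v} {S′ = S′})
                                   (≤-trans (+-mono-≤ deg′≤1 ≤-refl) (≰⇒> lv≱k))
    ... | yes k≤lv = allPeeled⇒LowOutsideVertex v∈S′ v∈S─A A⊆removed lost⊆v (≤-trans lv≤removed removed≤k)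
      where
      lv≤removed : ∣ lost H S S′ ∩ edgesAt H v ∣ ≤ ∣ S ─ S′ ∣
      lv≤removed = ∣lost∩edgesAt∣≤∣S─S′∣ H linear {S = S} v∈S′
      removed≤k : ∣ S ─ S′ ∣ ≤ k
      removed≤k = ≤-trans (p⊆q⇒∣p∣≤∣q∣ removed⊆A) ∣A∣≤k
      A⊆removed : A ⊆ S ─ S′
      A⊆removed = p⊆q∧∣q∣≤∣p∣⇒q⊆p removed⊆A (≤-trans ∣A∣≤k (≤-trans k≤lv lv≤removed))
      lost⊆v : lost H S S′ ⊆ edgesAt H v
      lost⊆v e∈ = proj₂ (x∈p∩q⁻ _ _ (p⊆q∧∣q∣≤∣p∣⇒q⊆p (p∩q⊆p _ (edgesAt H v))
                    (≤-trans ∣lost∣≤∣removed∣ (≤-trans removed≤k k≤lv)) e∈))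

    stuck⇒LowOutsideVertex : (∀ {w} → w ∈ S′ → w ∈ A → 1 < inducedDeg H S′ w) → Nonempty (S ─ A) →
      LowOutsideVertex
    stuck⇒LowOutsideVertex high (t , t∈S─A) with low (t , S─A⊆S′ t∈S─A)
    ... | v , v∈S′ , deg′≤1 = lowVertex⇒LowOutsideVertex v∈S′
      (x∈p∧x∉q⇒x∈p─q (S′⊆S v∈S′) λ v∈A → <⇒≱ (high v∈S′ v∈A) deg′≤1) deg′≤1

  peel : Nonempty (S ─ A) → ∀ {S′} → Acc _⊂_ S′ → Peeled S′ → LowOutsideVertex
  peel S─A≠∅ {S′} (acc smaller) peeled with any? (λ w → (w ∈? S′ ×-dec w ∈? A) ×-dec inducedDeg H S′ w ≤? 1)
  ... | yes (w , (w∈S′ , w∈A) , deg≤1) =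
    peel S─A≠∅ (smaller (x∈p⇒p-x⊂p w∈S′)) (peel-step peeled w∈S′ w∈A deg≤1)
  ... | no  none =
    stuck⇒LowOutsideVertex peeled (λ w∈S′ w∈A → ≰⇒> λ deg≤1 → none (_ , (w∈S′ , w∈A) , deg≤1)) S─A≠∅

  ∃-outside-inducedDeg≤k : Nonempty (S ─ A) → LowOutsideVertex
  ∃-outside-inducedDeg≤k S─A≠∅ = peel S─A≠∅ (⊂-wellFounded S) nothingPeeled

-- For k, d ≥ 2 one has d + max(k, d) ≤ kd.
d+a≰k*d⇒d≤1×a≤k : ∀ {k d a} → 2 ≤ k → a ≤ k ⊔ d → ¬ (d + a ≤ k * d) → d ≤ 1 × a ≤ k
d+a≰k*d⇒d≤1×a≤k {k} {zero}      _   a≤k⊔d _ = z≤n , subst (_ ≤_) (⊔-identityʳ k) a≤k⊔d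
d+a≰k*d⇒d≤1×a≤k {k} {suc zero}  2≤k a≤k⊔1 _ = ≤-refl , ≤-trans a≤k⊔1 (⊔-lub ≤-refl (≤-trans (s≤s z≤n) 2≤k))
d+a≰k*d⇒d≤1×a≤k {d = d@(suc (suc _))} (s≤s (s≤s {n = k} _)) a≤k⊔d d+a≰k*d =
  contradiction (+-monoʳ-≤ d (≤-trans a≤k⊔d (⊔-lub k+2≤ d≤))) d+a≰k*d
  where
  k+2≤ : suc (suc k) ≤ suc k * d
  k+2≤ = +-mono-≤ (s≤s (s≤s z≤n)) (m≤m*n k d)
  d≤ : d ≤ suc k * d
  d≤ = m≤n*m d (suc k)

module _ {n m} {H : Hypergraph n m} {k} (2≤k : 2 ≤ k) (uniform : Uniform H k) (linear : Linear H)
  {d} (isDeg : IsDegeneracy H d) where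

  private
    1≤d⇒k≤k*d : 1 ≤ d → k ≤ k * d
    1≤d⇒k≤k*d 1≤d = ≤-trans (≤-reflexive (sym (*-identityʳ k))) (*-monoʳ-≤ k 1≤d)

  -- When d = 0 the hypergraph has no edges, so all degrees vanish.
  inducedDeg≤k*d : ∀ {P v c} → inducedDeg H P v ≤ c → (1 ≤ d → c ≤ k * d) → inducedDeg H P v ≤ k * d
  inducedDeg≤k*d {P} {v} deg≤c c≤k*d with 1 ≤? d
  ... | yes 1≤d = ≤-trans deg≤c (c≤k*d 1≤d)
  ... | no  d≱1 = ≤-trans (≤-reflexive (Empty⇒∣p∣≡0 {p = star H P v} λ { (e , _) →
                    d≱1 (edge⇒1≤degeneracy H uniform (≤-trans (s≤s z≤n) 2≤k) isDeg e) })) z≤n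

  ⊆A⇒inducedDeg≤k*d : ∀ {A P} → ∣ A ∣ ≤ k ⊔ d → P ⊆ A → ∀ w → inducedDeg H P w ≤ k * d
  ⊆A⇒inducedDeg≤k*d {A} {P} ∣A∣≤k⊔d P⊆A w = inducedDeg≤k*d {v = w} deg≤∣A∣ λ 1≤d →
    ≤-trans ∣A∣≤k⊔d (⊔-lub (1≤d⇒k≤k*d 1≤d) d≤k*d)
    where
    d≤k*d : d ≤ k * d
    d≤k*d = ≤-trans (≤-reflexive (sym (*-identityˡ d))) (*-monoˡ-≤ d (≤-trans (s≤s z≤n) 2≤k))
    ∣⁅w⁆∣<k : ∣ ⁅ w ⁆ ∣ < k
    ∣⁅w⁆∣<k = ≤-trans (s≤s (≤-reflexive (∣⁅x⁆∣≡1 w))) 2≤k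
    deg≤∣A∣ : inducedDeg H P w ≤ ∣ A ∣
    deg≤∣A∣ = begin
      inducedDeg H P w                    ≤⟨ inducedDeg≤+removed H linear {v = w} {S′ = ⁅ w ⁆} (x∈⁅x⁆ w) ⟩
      inducedDeg H ⁅ w ⁆ w + ∣ P ─ ⁅ w ⁆ ∣ ≡⟨ cong (_+ ∣ P ─ ⁅ w ⁆ ∣) (∣P∣<k⇒inducedDeg≡0 H uniform {v = w} ∣⁅w⁆∣<k) ⟩
      ∣ P ─ ⁅ w ⁆ ∣                       ≤⟨ ∣p─q∣≤∣p∣ P ⁅ w ⁆ ⟩
      ∣ P ∣                               ≤⟨ p⊆q⇒∣p∣≤∣q∣ P⊆A ⟩
      ∣ A ∣                               ∎
      where open ≤-Reasoning

  ∃-outside-inducedDeg≤k*d : ∀ {A} → ∣ A ∣ ≤ k ⊔ d → ∀ {S} → Nonempty (S ─ A) →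
    ∃ λ v → v ∈ S ─ A × inducedDeg H S v ≤ k * d
  ∃-outside-inducedDeg≤k*d {A} ∣A∣≤k⊔d {S} S─A≠∅ with d + ∣ A ∣ ≤? k * d
  ... | yes fits with ∃-outside-inducedDeg≤c+∣A∣ linear (degeneracy⇒InducedMinDegree≤ H isDeg) S─A≠∅
  ...   | v , v∈S─A , deg≤ = v , v∈S─A , ≤-trans deg≤ fits
  ∃-outside-inducedDeg≤k*d {A} ∣A∣≤k⊔d {S} S─A≠∅ | no  tight with d+a≰k*d⇒d≤1×a≤k 2≤k ∣A∣≤k⊔d tight
  ... | d≤1 , ∣A∣≤k with Peeling.∃-outside-inducedDeg≤k 2≤k uniform linear low₁ ∣A∣≤k S─A≠∅
    where
    low₁ : InducedMinDegree≤ H 1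
    low₁ P≠∅ with degeneracy⇒InducedMinDegree≤ H isDeg P≠∅
    ... | v , v∈P , deg≤d = v , v∈P , ≤-trans deg≤d d≤1
  ...   | v , v∈S─A , deg≤k = v , v∈S─A , inducedDeg≤k*d {v = v} deg≤k 1≤d⇒k≤k*d

-- Orderings with a prescribed beginning

lastIndex : ∀ s → Fin (s + 1)
lastIndex s = s ↑ʳ zero

data SnocView {s : ℕ} : Fin (s + 1) → Set where
  old  : ∀ j → SnocView (j ↑ˡ 1)
  last : SnocView (lastIndex s)

snocView : ∀ {s} (i : Fin (s + 1)) → SnocView i
snocView {s} i with splitAt s i in eq
... | inj₁ j    = subst SnocView (splitAt⁻¹-↑ˡ eq) (old j)
... | inj₂ zero = subst SnocView (splitAt⁻¹-↑ʳ eq) last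

module _ {n m : ℕ} (H : Hypergraph n m) (D : ℕ) {ℓ : ℕ} (W : Fin ℓ → Fin n) where

  InitialSegment : ∀ {s} → (Fin s → Fin n) → Fin s → Subset n → Set
  InitialSegment f i P =
    (∀ {u} → u ∈ P → ∃ λ j → toℕ j ≤ toℕ i × f j ≡ u) × (∀ j → toℕ j ≤ toℕ i → f j ∈ P)

  record Elimination (S : Subset n) (s : ℕ) : Set where
    field
      vertex     : Fin s → Fin n
      injective  : Injective _≡_ _≡_ vertex
      vertex∈S   : ∀ i → vertex i ∈ S
      onto       : ∀ {u} → u ∈ S → ∃ λ i → vertex i ≡ u
      ℓ≤s        : ℓ ≤ s
      startsWith : ∀ (i : Fin ℓ) (j : Fin s) → toℕ i ≡ toℕ j → vertex j ≡ W i
      degenerate : ∀ i {P} → InitialSegment vertex i P → inducedDeg H P (vertex i) ≤ D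

  module Construction (W-injective : Injective _≡_ _≡_ W)
    (sparse : ∀ {P} → P ⊆ image W → ∀ w → inducedDeg H P w ≤ D)
    (peelable : ∀ {S} → Nonempty (S ─ image W) → ∃ λ v → v ∈ S ─ image W × inducedDeg H S v ≤ D)
    where

    base : ∀ {S} → image W ⊆ S → Empty (S ─ image W) → Elimination S ℓ
    base {S} W⊆S S─W=∅ = record
      { vertex     = W
      ; injective  = W-injective
      ; vertex∈S   = λ i → W⊆S (∈-image⁺ W i)
      ; onto       = onto
      ; ℓ≤s        = ≤-refl
      ; startsWith = λ i j i≡j → cong W (toℕ-injective (sym i≡j))
      ; degenerate = λ i (initial , _) → sparse (λ u∈P →
          let (j , _ , Wj≡u) = initial u∈P in subst (_∈ image W) Wj≡u (∈-image⁺ W j)) (W i)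
      }
      where
      onto : ∀ {u} → u ∈ S → ∃ λ i → W i ≡ u
      onto {u} u∈S with u ∈? image W
      ... | yes u∈W = ∈-image⁻ W u∈W
      ... | no  u∉W = contradiction (u , x∈p∧x∉q⇒x∈p─q u∈S u∉W) S─W=∅

    module Extend {S s v} (v∈S─W : v ∈ S ─ image W) (deg≤D : inducedDeg H S v ≤ D)
      (E : Elimination (S - v) s) where
      open Elimination E

      vertex′ : Fin (s + 1) → Fin n
      vertex′ = vertex Vector.++ (v Vector.∷ Vector.[])

      vertex′-old : ∀ j → vertex′ (j ↑ˡ 1) ≡ vertex j
      vertex′-old j = lookup-++ˡ vertex (v Vector.∷ Vector.[]) j

      vertex′-last : vertex′ (lastIndex s) ≡ v
      vertex′-last = lookup-++ʳ vertex (v Vector.∷ Vector.[]) zero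

      vertex≢v : ∀ j → vertex j ≢ v
      vertex≢v j = x∉⁅y⁆⇒x≢y (x∈p─q⇒x∉q (vertex∈S j))

      toℕ-last : toℕ (lastIndex s) ≡ s
      toℕ-last = trans (toℕ-↑ʳ s zero) (+-identityʳ s)

      toℕ≤last : ∀ (j : Fin (s + 1)) → toℕ j ≤ toℕ (lastIndex s)
      toℕ≤last j = subst (toℕ j ≤_) (sym toℕ-last) (≤-pred (subst (suc (toℕ j) ≤_) (+-comm s 1) (toℕ<n j)))

      injective′ : Injective _≡_ _≡_ vertex′
      injective′ {i} {j} eq with snocView i | snocView j
      ... | old a | old b = cong (_↑ˡ 1) (injective (trans (sym (vertex′-old a)) (trans eq (vertex′-old b))))
      ... | old a | last  = contradiction (trans (sym (vertex′-old a)) (trans eq vertex′-last)) (vertex≢v a)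
      ... | last  | old b =
        contradiction (trans (sym (vertex′-old b)) (trans (sym eq) vertex′-last)) (vertex≢v b)
      ... | last  | last  = refl

      vertex′∈S : ∀ i → vertex′ i ∈ S
      vertex′∈S i with snocView i
      ... | old j = subst (_∈ S) (sym (vertex′-old j)) (p─q⊆p _ _ (vertex∈S j))
      ... | last  = subst (_∈ S) (sym vertex′-last) (p─q⊆p _ _ v∈S─W)

      onto′ : ∀ {u} → u ∈ S → ∃ λ i → vertex′ i ≡ u
      onto′ {u} u∈S with u ≟ v
      ... | yes refl = lastIndex s , vertex′-last
      ... | no  u≢v  = let (j , vertex-j≡u) = onto (x∈p∧x≢y⇒x∈p-y u∈S u≢v)
                       in j ↑ˡ 1 , trans (vertex′-old j) vertex-j≡u

      startsWith′ : ∀ (i : Fin ℓ) (j : Fin (s + 1)) → toℕ i ≡ toℕ j → vertex′ j ≡ W i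
      startsWith′ i j i≡j with snocView j
      ... | old a = trans (vertex′-old a) (startsWith i a (trans i≡j (toℕ-↑ˡ a 1)))
      ... | last  = contradiction (≤-reflexive (sym (trans i≡j toℕ-last))) (<⇒≱ (≤-trans (toℕ<n i) ℓ≤s))

      degenerate′ : ∀ i {P} → InitialSegment vertex′ i P → inducedDeg H P (vertex′ i) ≤ D
      degenerate′ i {P} (initial , complete) with snocView i
      ... | old a rewrite vertex′-old a = degenerate a (initial′ , complete′)
        where
        initial′ : ∀ {u} → u ∈ P → ∃ λ j → toℕ j ≤ toℕ a × vertex j ≡ u
        initial′ u∈P with initial u∈P
        ... | j , j≤ , vertex′-j≡u with snocView j
        ...   | old b = b , subst₂ _≤_ (toℕ-↑ˡ b 1) (toℕ-↑ˡ a 1) j≤ , trans (sym (vertex′-old b)) vertex′-j≡u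
        ...   | last  = contradiction (subst₂ _≤_ toℕ-last (toℕ-↑ˡ a 1) j≤) (<⇒≱ (toℕ<n a))
        complete′ : ∀ j → toℕ j ≤ toℕ a → vertex j ∈ P
        complete′ j j≤a = subst (_∈ P) (vertex′-old j)
          (complete (j ↑ˡ 1) (subst₂ _≤_ (sym (toℕ-↑ˡ j 1)) (sym (toℕ-↑ˡ a 1)) j≤a))
      ... | last = subst₂ (λ Q x → inducedDeg H Q x ≤ D) (sym P≡S) (sym vertex′-last) deg≤D
        where
        P≡S : P ≡ S
        P≡S = ⊆-antisym
          (λ u∈P → let (j , _ , vertex′-j≡u) = initial u∈P in subst (_∈ S) vertex′-j≡u (vertex′∈S j))
          (λ u∈S → let (j , vertex′-j≡u) = onto′ u∈S in subst (_∈ P) vertex′-j≡u (complete j (toℕ≤last j)))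

      extended : Elimination S (s + 1)
      extended = record
        { vertex = vertex′ ; injective = injective′ ; vertex∈S = vertex′∈S ; onto = onto′
        ; ℓ≤s = ≤-trans ℓ≤s (m≤m+n s 1) ; startsWith = startsWith′ ; degenerate = degenerate′ }

    build : ∀ {S} → Acc _⊂_ S → image W ⊆ S → ∃ (Elimination S)
    build {S} (acc smaller) W⊆S with nonempty? (S ─ image W)
    ... | no  S─W=∅ = ℓ , base W⊆S S─W=∅
    ... | yes S─W≠∅ with peelable S─W≠∅
    ...   | v , v∈S─W , deg≤D with build (smaller (x∈p⇒p-x⊂p (p─q⊆p _ _ v∈S─W))) W⊆S-v
      where
      W⊆S-v : image W ⊆ S - v
      W⊆S-v u∈W = x∈p∧x≢y⇒x∈p-y (W⊆S u∈W) λ { refl → x∈p─q⇒x∉q v∈S─W u∈W }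
    ...     | s , E = s + 1 , Extend.extended v∈S─W deg≤D E

  StartsWith : Permutation′ n → Set
  StartsWith π = ∀ (i : Fin ℓ) (j : Fin n) → toℕ i ≡ toℕ j → π ⟨$⟩ʳ j ≡ W i

  size≡n : ∀ {s} → Elimination ⊤ s → s ≡ n
  size≡n {s} E = ≤-antisym (injective⇒≤ injective) (injective⇒≤ position-injective)
    where
    open Elimination E
    position : Fin n → Fin s
    position u = proj₁ (onto ∈⊤)
    position-injective : Injective _≡_ _≡_ position
    position-injective eq = trans (sym (proj₂ (onto ∈⊤))) (trans (cong vertex eq) (proj₂ (onto ∈⊤)))

  toPermutation : Elimination ⊤ n → ∃ λ π → Degenerate H D π × StartsWith π
  toPermutation E = π , (λ i → degenerate i (prefix-initial i)) , startsWith
    where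
    open Elimination E
    π : Permutation′ n
    π = permutation vertex (λ u → proj₁ (onto ∈⊤))
          (λ u → proj₂ (onto ∈⊤)) (λ i → injective (proj₂ (onto ∈⊤)))
    prefix-initial : ∀ i → InitialSegment vertex i (prefix H π i)
    prefix-initial i = initial , complete
      where
      initial : ∀ {u} → u ∈ prefix H π i → ∃ λ j → toℕ j ≤ toℕ i × vertex j ≡ u
      initial u∈ = π ⟨$⟩ˡ _ , ≤ᵇ⇒≤ _ _ (Equivalence.from T-≡ (∈-tabulate⁻ u∈)) , inverseʳ π
      complete : ∀ j → toℕ j ≤ toℕ i → vertex j ∈ prefix H π i
      complete j j≤i = ∈-tabulate⁺ (Equivalence.to T-≡
        (subst (λ x → T (toℕ x ≤ᵇ toℕ i)) (sym (inverseˡ π)) (≤⇒≤ᵇ j≤i)))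

  degenerateOrdering : Injective _≡_ _≡_ W →
    (∀ {P} → P ⊆ image W → ∀ w → inducedDeg H P w ≤ D) →
    (∀ {S} → Nonempty (S ─ image W) → ∃ λ v → v ∈ S ─ image W × inducedDeg H S v ≤ D) →
    ∃ λ π → Degenerate H D π × StartsWith π
  degenerateOrdering W-injective sparse peelable
    with Construction.build W-injective sparse peelable (⊂-wellFounded ⊤) ⊆⊤
  ... | s , E with size≡n E
  ... | refl = toPermutation E

proposition3p2 : ∀ {n m : ℕ} (H : Hypergraph n m) (k : ℕ) → 2 ≤ k →
    Uniform H k → Linear H →
    (d Δ : ℕ) → IsDegeneracy H d → IsMaxDegree H Δ →
    (ℓ : ℕ) → ℓ ≤ k ⊔ d →
    (W : Fin ℓ → Fin n) → Injective _≡_ _≡_ W →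
    ∃ λ (π : Permutation′ n) →
      Degenerate H ((k * d) ⊓ Δ) π ×
      (∀ (i : Fin ℓ) (j : Fin n) → toℕ i ≡ toℕ j → π ⟨$⟩ʳ j ≡ W i)
proposition3p2 H k 2≤k uniform linear d Δ isDeg isMax ℓ ℓ≤k⊔d W W-injective
  with degenerateOrdering H (k * d) W W-injective
         (⊆A⇒inducedDeg≤k*d 2≤k uniform linear isDeg {A = image W} ∣W∣≤k⊔d)
         (λ {S} → ∃-outside-inducedDeg≤k*d 2≤k uniform linear isDeg {A = image W} ∣W∣≤k⊔d {S})
  where
  ∣W∣≤k⊔d : ∣ image W ∣ ≤ k ⊔ d
  ∣W∣≤k⊔d = ≤-trans (∣image∣≤ W) ℓ≤k⊔d
... | π , kd-degenerate , startsWith =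
  π , Degenerate-⊓ H {π = π} kd-degenerate (maxDegree⇒Degenerate H isMax π) , startsWith
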